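{- Let $I_{2^k}$ be the $2^k\times2^k$ binary identity matrix. Then $b(I_{2^k})=O(1)$ and $b(\mathtt{phlin}(I_{2^k}))=\Omega(k)$, as $k\to\infty$.
   Context: For a matrix $\mathcal{M}$ of size $2^i\times2^i$, $i\ge1$, its quadrants are $UL(\mathcal{M})=\mathcal{M}[1..2^{i-1}][1..2^{i-1}]$, $UR(\mathcal{M})=\mathcal{M}[1..2^{i-1}][2^{i-1}+1..2^i]$, $LL(\mathcal{M})=\mathcal{M}[2^{i-1}+1..2^i][1..2^{i-1}]$, $LR(\mathcal{M})=\mathcal{M}[2^{i-1}+1..2^i][2^{i-1}+1..2^i]$. Scans $\mathtt{ls},\mathtt{rs},\mathtt{us},\mathtt{ds}$ map $2^i\times2^i$ matrices to 1D strings: all equal the single symbol for $1\times1$ matrices; otherwise $\mathtt{rs}(\mathcal{M})=\mathtt{ds}(UL)\mathtt{rs}(UR)\mathtt{rs}(LR)\mathtt{us}(LL)$, $\mathtt{ds}(\mathcal{M})=\mathtt{rs}(UL)\mathtt{ds}(LL)\mathtt{ds}(LR)\mathtt{ls}(UR)$, $\mathtt{us}(\mathcal{M})=\mathtt{ls}(LR)\mathtt{us}(UR)\mathtt{us}(UL)\mathtt{rs}(LL)$, $\mathtt{ls}(\mathcal{M})=\mathtt{us}(LR)\mathtt{ls}(LL)\mathtt{ls}(UL)\mathtt{ds}(UR)$ (quadrants of $\mathcal{M}$, juxtaposition = concatenation). $\mathtt{phlin}(\mathcal{M})=\mathtt{rs}(\mathcal{M})$ if $i$ is odd, $\mathtt{ds}(\mathcal{M})$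 if $i$ is even. A 2D macro scheme for an $m\times n$ matrix $\mathcal{M}$ is a factorization into disjoint rectangular phrases, each an explicit $1\times1$ phrase or a copied phrase with a source (an equal submatrix of $\mathcal{M}$ whose top-left corner is at a different position), inducing $\mathtt{map}$ on positions $\cup\{\bot\}$ with $\mathtt{map}(\bot)=\bot$, $\mathtt{map}=\bot$ on explicit phrases, and for a copied phrase $\mathcal{M}[i_1..j_1][i_2..j_2]$, $\mathtt{map}(i_1+t_1,i_2+t_2)=\mathtt{map}(i_1,i_2)+(t_1,t_2)$ where $\mathtt{map}(i_1,i_2)$ is the top-left corner of its source; it is valid if every position reaches $\bot$ under some iterate of $\mathtt{map}$. $b(\mathcal{M})$ is the minimum number of phrases of a valid macro scheme; a 1D string is treated as a $1\times n$ matrix (giving the usual bidirectional macro scheme measure). -}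

module Defs where

open import Data.Nat using (ℕ; zero; suc; _+_; _*_; _∸_; _^_; _≤_; _<_; _≤ᵇ_; _<ᵇ_; _≡ᵇ_)
open import Data.Bool using (Bool; true; false; _∧_; if_then_else_; T)
open import Data.List using (List; []; _∷_; _++_; length)
open import Data.List.Relation.Unary.Any using (Any)
open import Data.List.Relation.Unary.AllPairs using (AllPairs)
open import Data.Maybe using (Maybe; just; nothing)
open import Data.Product using (_×_; _,_; Σ; ∃)
open import Data.Empty using (⊥)
open import Relation.Binary.PropositionalEquality using (_≡_; _≢_)
open import Data.List.Membership.Propositional using (_∈_)

-- Matrices: an m × n matrix is given by its entry function on ℕ × ℕ
-- (0-based); only positions i < m, j < n are ever inspected.

Mat : Set → Set
Mat A = ℕ → ℕ → A

Id : Mat Bool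
Id i j = i ≡ᵇ j

-- a 1D string seen as a 1 × length matrix (default value for
-- out-of-range entries, never inspected)
rowMat : {A : Set} → A → List A → Mat A
rowMat d []       r j       = d
rowMat d (x ∷ xs) r zero    = x
rowMat d (x ∷ xs) r (suc j) = rowMat d xs r j

UL UR LL LR : {A : Set} → ℕ → Mat A → Mat A
UL i M a b = M a b
UR i M a b = M a (b + 2 ^ i)
LL i M a b = M (a + 2 ^ i) b
LR i M a b = M (a + 2 ^ i) (b + 2 ^ i)

rs ds us ls : {A : Set} → ℕ → Mat A → List A
rs zero    M = M 0 0 ∷ []
rs (suc i) M = ds i (UL i M) ++ rs i (UR i M) ++ rs i (LR i M) ++ us i (LL i M)
ds zero    M = M 0 0 ∷ []
ds (suc i) M = rs i (UL i M) ++ ds i (LL i M) ++ ds i (LR i M) ++ ls i (UR i M)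
us zero    M = M 0 0 ∷ []
us (suc i) M = ls i (LR i M) ++ us i (UR i M) ++ us i (UL i M) ++ rs i (LL i M)
ls zero    M = M 0 0 ∷ []
ls (suc i) M = us i (LR i M) ++ ls i (LL i M) ++ ls i (UL i M) ++ ds i (UR i M)

odd : ℕ → Bool
odd zero          = false
odd (suc zero)    = true
odd (suc (suc n)) = odd n

phlin : {A : Set} → ℕ → Mat A → List A
phlin i M = if odd i then rs i M else ds i M

Pos : Set
Pos = ℕ × ℕ

-- A phrase: top-left corner (row , col), height h, width w, and
-- either explicit (src = nothing) or copied with the top-left corner
-- of its source (src = just (sr , sc)).
record Phrase : Set where
  constructor phrase
  field
    row col h w : ℕ
    src : Maybe Pos
open Phrase public

insideᵇ : Phrase → ℕ → ℕ → Bool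
insideᵇ p i j = (row p ≤ᵇ i) ∧ (i <ᵇ row p + h p) ∧ (col p ≤ᵇ j) ∧ (j <ᵇ col p + w p)

Inside : Phrase → ℕ → ℕ → Set
Inside p i j = T (insideᵇ p i j)

WellFormed : {A : Set} → ℕ → ℕ → Mat A → Phrase → Set
WellFormed m n M p with src p
... | nothing = row p < m × col p < n × h p ≡ 1 × w p ≡ 1
... | just (sr , sc) =
      1 ≤ h p × 1 ≤ w p × row p + h p ≤ m × col p + w p ≤ n
      × sr + h p ≤ m × sc + w p ≤ n
      × (sr , sc) ≢ (row p , col p)
      × (∀ t₁ t₂ → t₁ < h p → t₂ < w p →
           M (sr + t₁) (sc + t₂) ≡ M (row p + t₁) (col p + t₂))

Disjoint : Phrase → Phrase → Set
Disjoint p q = ∀ i j → Inside p i j → Inside q i j → ⊥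

Factorization : ℕ → ℕ → List Phrase → Set
Factorization m n ps =
  (∀ i j → i < m → j < n → Any (λ p → Inside p i j) ps)
  × AllPairs Disjoint ps

-- the induced map on positions ∪ {⊥} (⊥ = nothing)
mapPos : List Phrase → Pos → Maybe Pos
mapPos [] _ = nothing
mapPos (p ∷ ps) (i , j) with insideᵇ p i j
... | false = mapPos ps (i , j)
... | true with src p
...   | nothing = nothing
...   | just (sr , sc) = just (sr + (i ∸ row p) , sc + (j ∸ col p))

mapM : List Phrase → Maybe Pos → Maybe Pos
mapM ps nothing  = nothing
mapM ps (just x) = mapPos ps x

iterate : {X : Set} → (X → X) → ℕ → X → X
iterate f zero    x = x
iterate f (suc t) x = f (iterate f t x)

ValidScheme : {A : Set} → ℕ → ℕ → Mat A → List Phrase → Set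
ValidScheme m n M ps =
  Factorization m n ps
  × (∀ p → p ∈ ps → WellFormed m n M p)
  × (∀ i j → i < m → j < n → ∃ λ t → iterate (mapM ps) t (just (i , j)) ≡ nothing)

b≤ : {A : Set} → ℕ → ℕ → Mat A → ℕ → Set
b≤ m n M s = Σ (List Phrase) λ ps → ValidScheme m n M ps × length ps ≤ s

strMat : List Bool → Mat Bool
strMat = rowMat false

{-# OPTIONS --safe #-}
-- Upper bound: apart from three explicit cells, I_N is covered by three copies of itself
-- shifted by one step (along the first row, down the first column, and diagonally).
-- Lower bound: in rs and ds the off-diagonal quadrants scan to zeros, so phlin(I_{2^k}) is
-- S_k, where S_0 = 1 and S_{j+1} = S_j 0^{4^j} S_j 0^{4^j}; for each j < k it contains the
-- word 1 0^n 1 with n = (4^{j+1} - 1)/3. Tracing an occurrence of such a word back through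
-- the copies of a valid macro scheme must stop, and it can only stop at an occurrence inside
-- which some phrase ends. A phrase cannot end inside occurrences of 1 0^m 1 and 1 0^n 1 with
-- m ≠ n, so the k words need k distinct phrases.
module Submission where

open import Defs
open import Data.Bool using (Bool; true; false; T)
open import Data.Bool.Properties using (T-∧)
open import Data.Empty using (⊥-elim)
open import Data.Fin using (Fin; toℕ)
open import Data.Fin.Properties using (toℕ-injective; toℕ<n; injective⇒≤)
open import Data.List using (List; []; _∷_; _++_; length; replicate; lookup)
open import Data.List.Properties
  using (++-assoc; ++-identityʳ; ++-monoid; length-++; length-++-≤ˡ; length-replicate)
open import Data.List.Membership.Propositional using (_∈_; find; lose)
open import Data.List.Relation.Unary.All using ([]; _∷_)
import Data.List.Relation.Unary.All as All
open import Data.List.Relation.Unary.AllPairs using (AllPairs; []; _∷_)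
import Data.List.Relation.Unary.AllPairs as AllPairs
open import Data.List.Relation.Unary.Any using (Any; here; there; index)
open import Data.List.Relation.Unary.Any.Properties using (lookup-index)
open import Data.Maybe using (Maybe; just; nothing)
open import Data.Nat using (ℕ; zero; suc; _+_; _*_; _∸_; _^_; _≤_; _<_; _≡ᵇ_; z≤n; s≤s; _≤?_)
open import Data.Nat.Properties
open import Data.Product using (Σ; _×_; _,_; ∃; ∃₂; proj₁; proj₂)
open import Data.Sum using (_⊎_; inj₁; inj₂)
open import Function.Base using (_∘_)
open import Function.Bundles using (module Equivalence)
open import Function.Definitions using (Injective)
open import Relation.Binary.Definitions using (tri<; tri≈; tri>)
open import Relation.Binary.PropositionalEquality
open import Relation.Nullary using (yes; no)
open import Tactic.MonoidSolver using (solve)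

open Equivalence using (to; from)

inside⇒bounds : ∀ p {i j} → Inside p i j →
                row p ≤ i × i < row p + h p × col p ≤ j × j < col p + w p
inside⇒bounds p ins =
  let r≤i   , ins₁  = to T-∧ ins
      i<r+h , ins₂  = to T-∧ ins₁
      c≤j   , j<c+w = to T-∧ ins₂
  in ≤ᵇ⇒≤ _ _ r≤i , <ᵇ⇒< _ _ i<r+h , ≤ᵇ⇒≤ _ _ c≤j , <ᵇ⇒< _ _ j<c+w

bounds⇒inside : ∀ p {i j} → row p ≤ i → i < row p + h p → col p ≤ j → j < col p + w p →
                Inside p i j
bounds⇒inside p r≤i i<r+h c≤j j<c+w =
  from T-∧ (≤⇒≤ᵇ r≤i , from T-∧ (<⇒<ᵇ i<r+h , from T-∧ (≤⇒≤ᵇ c≤j , <⇒<ᵇ j<c+w)))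

data Separated (p q : Phrase) : Set where
  above   : row p + h p ≤ row q → Separated p q
  below   : row q + h q ≤ row p → Separated p q
  leftOf  : col p + w p ≤ col q → Separated p q
  rightOf : col q + w q ≤ col p → Separated p q

separated⇒disjoint : ∀ {p q} → Separated p q → Disjoint p q
separated⇒disjoint {p} {q} sep i j ∈p ∈q
  with inside⇒bounds p ∈p | inside⇒bounds q ∈q | sep
... | _ , i<p , _ , _ | q≤i , _ , _ , _ | above p≤q   = <⇒≱ (<-≤-trans i<p p≤q) q≤i
... | p≤i , _ , _ , _ | _ , i<q , _ , _ | below q≤p   = <⇒≱ (<-≤-trans i<q q≤p) p≤i
... | _ , _ , _ , j<p | _ , _ , q≤j , _ | leftOf p≤q  = <⇒≱ (<-≤-trans j<p p≤q) q≤j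
... | _ , _ , p≤j , _ | _ , _ , _ , j<q | rightOf q≤p = <⇒≱ (<-≤-trans j<q q≤p) p≤j

mapPhrase : Phrase → Pos → Maybe Pos
mapPhrase p (i , j) with src p
... | nothing        = nothing
... | just (sr , sc) = just (sr + (i ∸ row p) , sc + (j ∸ col p))

mapPos-inside : ∀ {ps p} i j → AllPairs Disjoint ps → p ∈ ps → Inside p i j →
                mapPos ps (i , j) ≡ mapPhrase p (i , j)
mapPos-inside {q ∷ ps} i j (q#ps ∷ disjoint) p∈ ∈p with insideᵇ q i j in ∈q | p∈
... | true  | here refl with src q
...   | nothing = refl
...   | just _  = refl
mapPos-inside i j (q#ps ∷ disjoint) p∈ ∈p | true  | there p∈ps =
  ⊥-elim (All.lookup q#ps p∈ps _ _ (subst T (sym ∈q) _) ∈p)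
mapPos-inside i j (q#ps ∷ disjoint) p∈ ∈p | false | here refl  = ⊥-elim (subst T ∈q ∈p)
mapPos-inside i j (q#ps ∷ disjoint) p∈ ∈p | false | there p∈ps = mapPos-inside i j disjoint p∈ps ∈p

Resolves : List Phrase → Pos → Set
Resolves ps x = ∃ λ t → iterate (mapM ps) t (just x) ≡ nothing

iterate-suc : ∀ {X : Set} (f : X → X) t x → iterate f (suc t) x ≡ iterate f t (f x)
iterate-suc f zero    x = refl
iterate-suc f (suc t) x = cong f (iterate-suc f t x)

explicit⇒resolves : ∀ {ps x} → mapPos ps x ≡ nothing → Resolves ps x
explicit⇒resolves ⊥-now = 1 , ⊥-now

copied⇒resolves : ∀ {ps x y} → mapPos ps x ≡ just y → Resolves ps y → Resolves ps x
copied⇒resolves {ps} {x} x↦y (t , y⇝⊥) =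
  suc t , trans (iterate-suc (mapM ps) t (just x)) (trans (cong (iterate (mapM ps) t) x↦y) y⇝⊥)

-- A six-phrase scheme for the identity matrix

b≤-Id-0 : b≤ 0 0 Id 6
b≤-Id-0 = [] , (((λ _ _ ()) , []) , (λ _ ()) , (λ _ _ ())) , z≤n

b≤-Id-1 : b≤ 1 1 Id 6
b≤-Id-1 = cell ∷ [] , ((covers , [] ∷ []) , wellFormed , resolves) , s≤s z≤n
  where
  cell = phrase 0 0 1 1 nothing
  covers : ∀ i j → i < 1 → j < 1 → Any (λ p → Inside p i j) (cell ∷ [])
  covers zero    zero    _         _         = here _
  covers zero    (suc _) _         (s≤s ())
  covers (suc _) _       (s≤s ()) _
  wellFormed : ∀ p → p ∈ cell ∷ [] → WellFormed 1 1 Id p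
  wellFormed _ (here refl) = 0<1+n , 0<1+n , refl , refl
  resolves : ∀ i j → i < 1 → j < 1 → Resolves (cell ∷ []) (i , j)
  resolves zero    zero    _         _         = explicit⇒resolves refl
  resolves zero    (suc _) _         (s≤s ())
  resolves (suc _) _       (s≤s ()) _

b≤-Id-2 : b≤ 2 2 Id 6
b≤-Id-2 = cells , ((covers , disjoint) , wellFormed , resolves) , s≤s (s≤s (s≤s (s≤s z≤n)))
  where
  c₀₀ c₀₁ c₁₀ c₁₁ : Phrase
  c₀₀ = phrase 0 0 1 1 nothing
  c₀₁ = phrase 0 1 1 1 nothing
  c₁₀ = phrase 1 0 1 1 nothing
  c₁₁ = phrase 1 1 1 1 nothing
  cells = c₀₀ ∷ c₀₁ ∷ c₁₀ ∷ c₁₁ ∷ []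
  covers : ∀ i j → i < 2 → j < 2 → Any (λ p → Inside p i j) cells
  covers 0 0 _ _ = here _
  covers 0 1 _ _ = there (here _)
  covers 1 0 _ _ = there (there (here _))
  covers 1 1 _ _ = there (there (there (here _)))
  covers 0 (suc (suc _)) _ (s≤s (s≤s ()))
  covers 1 (suc (suc _)) _ (s≤s (s≤s ()))
  covers (suc (suc _)) _ (s≤s (s≤s ())) _
  disjoint : AllPairs Disjoint cells
  disjoint = AllPairs.map {R = Separated} separated⇒disjoint
    ( (leftOf ≤-refl ∷ above ≤-refl ∷ above ≤-refl ∷ [])
    ∷ (above ≤-refl ∷ above ≤-refl ∷ [])
    ∷ (leftOf ≤-refl ∷ [])
    ∷ [] ∷ [])
  wellFormed : ∀ p → p ∈ cells → WellFormed 2 2 Id p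
  wellFormed _ (here refl)                         = 0<1+n , 0<1+n , refl , refl
  wellFormed _ (there (here refl))                 = 0<1+n , ≤-refl , refl , refl
  wellFormed _ (there (there (here refl)))         = ≤-refl , 0<1+n , refl , refl
  wellFormed _ (there (there (there (here refl)))) = ≤-refl , ≤-refl , refl , refl
  resolves : ∀ i j → i < 2 → j < 2 → Resolves cells (i , j)
  resolves 0 0 _ _ = explicit⇒resolves refl
  resolves 0 1 _ _ = explicit⇒resolves refl
  resolves 1 0 _ _ = explicit⇒resolves refl
  resolves 1 1 _ _ = explicit⇒resolves refl
  resolves 0 (suc (suc _)) _ (s≤s (s≤s ()))
  resolves 1 (suc (suc _)) _ (s≤s (s≤s ()))
  resolves (suc (suc _)) _ (s≤s (s≤s ())) _

module SixPhraseScheme (n : ℕ) where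

  N : ℕ
  N = 3 + n

  corner top₁ left₁ topRest leftRest interior : Phrase
  corner   = phrase 0 0 1 1 nothing
  top₁     = phrase 0 1 1 1 nothing
  topRest  = phrase 0 2 1 (suc n) (just (0 , 1))
  left₁    = phrase 1 0 1 1 nothing
  leftRest = phrase 2 0 (suc n) 1 (just (1 , 0))
  interior = phrase 1 1 (2 + n) (2 + n) (just (0 , 0))

  phrases : List Phrase
  phrases = corner ∷ top₁ ∷ topRest ∷ left₁ ∷ leftRest ∷ interior ∷ []

  disjoint : AllPairs Disjoint phrases
  disjoint = AllPairs.map {R = Separated} separated⇒disjoint
    ( (leftOf ≤-refl ∷ leftOf 1≤2 ∷ above ≤-refl ∷ above 1≤2 ∷ above ≤-refl ∷ [])
    ∷ (leftOf ≤-refl ∷ above ≤-refl ∷ above 1≤2 ∷ above ≤-refl ∷ [])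
    ∷ (above ≤-refl ∷ above 1≤2 ∷ above ≤-refl ∷ [])
    ∷ (above ≤-refl ∷ leftOf ≤-refl ∷ [])
    ∷ (leftOf ≤-refl ∷ [])
    ∷ [] ∷ [])
    where
    1≤2 : 1 ≤ 2
    1≤2 = s≤s z≤n

  corner∈ : corner ∈ phrases
  corner∈ = here refl
  top₁∈ : top₁ ∈ phrases
  top₁∈ = there (here refl)
  topRest∈ : topRest ∈ phrases
  topRest∈ = there (there (here refl))
  left₁∈ : left₁ ∈ phrases
  left₁∈ = there (there (there (here refl)))
  leftRest∈ : leftRest ∈ phrases
  leftRest∈ = there (there (there (there (here refl))))
  interior∈ : interior ∈ phrases
  interior∈ = there (there (there (there (there (here refl)))))

  in-corner : Inside corner 0 0
  in-corner = bounds⇒inside corner z≤n 0<1+n z≤n 0<1+n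
  in-top₁ : Inside top₁ 0 1
  in-top₁ = bounds⇒inside top₁ z≤n 0<1+n ≤-refl ≤-refl
  in-topRest : ∀ j → 2 + j < N → Inside topRest 0 (2 + j)
  in-topRest j j< = bounds⇒inside topRest z≤n 0<1+n (s≤s (s≤s z≤n)) j<
  in-left₁ : Inside left₁ 1 0
  in-left₁ = bounds⇒inside left₁ ≤-refl ≤-refl z≤n 0<1+n
  in-leftRest : ∀ i → 2 + i < N → Inside leftRest (2 + i) 0
  in-leftRest i i< = bounds⇒inside leftRest (s≤s (s≤s z≤n)) i< z≤n 0<1+n
  in-interior : ∀ i j → suc i < N → suc j < N → Inside interior (suc i) (suc j)
  in-interior i j i< j< = bounds⇒inside interior (s≤s z≤n) i< (s≤s z≤n) j<

  covers : ∀ i j → i < N → j < N → Any (λ p → Inside p i j) phrases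
  covers zero          zero          _  _  = lose corner∈ in-corner
  covers zero          (suc zero)    _  _  = lose top₁∈ in-top₁
  covers zero          (suc (suc j)) _  j< = lose topRest∈ (in-topRest j j<)
  covers (suc zero)    zero          _  _  = lose left₁∈ in-left₁
  covers (suc (suc i)) zero          i< _  = lose leftRest∈ (in-leftRest i i<)
  covers (suc i)       (suc j)       i< j< = lose interior∈ (in-interior i j i< j<)

  wellFormed : ∀ p → p ∈ phrases → WellFormed N N Id p
  wellFormed _ (here refl)                                 = 0<1+n , 0<1+n , refl , refl
  wellFormed _ (there (here refl))                         = 0<1+n , s≤s 0<1+n , refl , refl
  wellFormed _ (there (there (here refl)))                 =
    0<1+n , 0<1+n , 0<1+n , ≤-refl , 0<1+n , n≤1+n _ , (λ ()) , zero-row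
    where
    zero-row : ∀ t₁ t₂ → t₁ < 1 → t₂ < suc n → Id (0 + t₁) (1 + t₂) ≡ Id (0 + t₁) (2 + t₂)
    zero-row zero    _ _         _ = refl
    zero-row (suc _) _ (s≤s ()) _
  wellFormed _ (there (there (there (here refl))))         = s≤s 0<1+n , 0<1+n , refl , refl
  wellFormed _ (there (there (there (there (here refl))))) =
    0<1+n , 0<1+n , ≤-refl , 0<1+n , n≤1+n _ , 0<1+n , (λ ()) , zero-column
    where
    zero-column : ∀ t₁ t₂ → t₁ < suc n → t₂ < 1 → Id (1 + t₁) (0 + t₂) ≡ Id (2 + t₁) (0 + t₂)
    zero-column _ zero    _ _         = refl
    zero-column _ (suc _) _ (s≤s ())
  wellFormed _ (there (there (there (there (there (here refl)))))) =
    0<1+n , 0<1+n , ≤-refl , ≤-refl , n≤1+n _ , n≤1+n _ , (λ ()) , (λ _ _ _ _ → refl)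

  resolves : ∀ i j → i < N → j < N → Resolves phrases (i , j)
  resolves zero          zero          _  _  =
    explicit⇒resolves (mapPos-inside 0 0 disjoint corner∈ in-corner)
  resolves zero          (suc zero)    _  _  =
    explicit⇒resolves (mapPos-inside 0 1 disjoint top₁∈ in-top₁)
  resolves zero          (suc (suc j)) i< j< =
    copied⇒resolves (mapPos-inside 0 (2 + j) disjoint topRest∈ (in-topRest j j<))
                    (resolves 0 (suc j) i< (<⇒≤ j<))
  resolves (suc zero)    zero          _  _  =
    explicit⇒resolves (mapPos-inside 1 0 disjoint left₁∈ in-left₁)
  resolves (suc (suc i)) zero          i< j< =
    copied⇒resolves (mapPos-inside (2 + i) 0 disjoint leftRest∈ (in-leftRest i i<))
                    (resolves (suc i) 0 (<⇒≤ i<) j<)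
  resolves (suc i)       (suc j)       i< j< =
    copied⇒resolves (mapPos-inside (suc i) (suc j) disjoint interior∈ (in-interior i j i< j<))
                    (resolves i j (<⇒≤ i<) (<⇒≤ j<))

  scheme : b≤ N N Id 6
  scheme = phrases , ((covers , disjoint) , wellFormed , resolves) , ≤-refl

b≤-Id : ∀ N → b≤ N N Id 6
b≤-Id 0                   = b≤-Id-0
b≤-Id 1                   = b≤-Id-1
b≤-Id 2                   = b≤-Id-2
b≤-Id (suc (suc (suc n))) = SixPhraseScheme.scheme n

-- Scanning the identity matrix

zeros : ℕ → List Bool
zeros n = replicate n false

zeros-++ : ∀ m n → zeros m ++ zeros n ≡ zeros (m + n)
zeros-++ zero    n = refl
zeros-++ (suc m) n = cong (false ∷_) (zeros-++ m n)

zeros-quarters : ∀ i {A B C D} → A ≡ zeros (4 ^ i) → B ≡ zeros (4 ^ i) → C ≡ zeros (4 ^ i) →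
                 D ≡ zeros (4 ^ i) → A ++ B ++ C ++ D ≡ zeros (4 ^ suc i)
zeros-quarters i refl refl refl refl = begin
  zeros q ++ zeros q ++ zeros q ++ zeros q  ≡⟨ cong (λ X → zeros q ++ zeros q ++ X) (zeros-++ q q) ⟩
  zeros q ++ zeros q ++ zeros (q + q)       ≡⟨ cong (zeros q ++_) (zeros-++ q (q + q)) ⟩
  zeros q ++ zeros (q + (q + q))            ≡⟨ zeros-++ q (q + (q + q)) ⟩
  zeros (q + (q + (q + q)))                 ≡⟨ cong (λ m → zeros (q + (q + (q + m)))) (+-identityʳ q) ⟨
  zeros (4 ^ suc i)                         ∎
  where
  open ≡-Reasoning
  q = 4 ^ i

idScan : ℕ → List Bool
idScan zero    = true ∷ []
idScan (suc k) = idScan k ++ zeros (4 ^ k) ++ idScan k ++ zeros (4 ^ k)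

ZeroBlock IdentityBlock : ℕ → Mat Bool → Set
ZeroBlock     i M = ∀ a b → a < 2 ^ i → b < 2 ^ i → M a b ≡ false
IdentityBlock i M = ∀ a b → a < 2 ^ i → b < 2 ^ i → M a b ≡ (a ≡ᵇ b)

lower-half : ∀ i {a} → a < 2 ^ i → a < 2 ^ suc i
lower-half i a< = ≤-trans a< (m≤m+n (2 ^ i) _)

upper-half : ∀ i {a} → a < 2 ^ i → a + 2 ^ i < 2 ^ suc i
upper-half i {a} a< =
  subst (a + 2 ^ i <_) (cong (2 ^ i +_) (sym (+-identityʳ (2 ^ i)))) (+-monoˡ-< (2 ^ i) a<)

≢⇒≡ᵇ-false : ∀ {m n} → m ≢ n → (m ≡ᵇ n) ≡ false
≢⇒≡ᵇ-false {m} {n} m≢n with m ≡ᵇ n in eq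
... | true  = ⊥-elim (m≢n (≡ᵇ⇒≡ m n (subst T (sym eq) _)))
... | false = refl

+-cancelʳ-≡ᵇ : ∀ a b c → (a + c ≡ᵇ b + c) ≡ (a ≡ᵇ b)
+-cancelʳ-≡ᵇ a b zero    rewrite +-identityʳ a | +-identityʳ b = refl
+-cancelʳ-≡ᵇ a b (suc c) rewrite +-suc a c | +-suc b c = +-cancelʳ-≡ᵇ a b c

module _ (i : ℕ) {M : Mat Bool} where

  ZeroBlock-UL : ZeroBlock (suc i) M → ZeroBlock i (UL i M)
  ZeroBlock-UL z a b a< b< = z a b (lower-half i a<) (lower-half i b<)

  ZeroBlock-UR : ZeroBlock (suc i) M → ZeroBlock i (UR i M)
  ZeroBlock-UR z a b a< b< = z a (b + 2 ^ i) (lower-half i a<) (upper-half i b<)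

  ZeroBlock-LL : ZeroBlock (suc i) M → ZeroBlock i (LL i M)
  ZeroBlock-LL z a b a< b< = z (a + 2 ^ i) b (upper-half i a<) (lower-half i b<)

  ZeroBlock-LR : ZeroBlock (suc i) M → ZeroBlock i (LR i M)
  ZeroBlock-LR z a b a< b< = z (a + 2 ^ i) (b + 2 ^ i) (upper-half i a<) (upper-half i b<)

  IdentityBlock-UL : IdentityBlock (suc i) M → IdentityBlock i (UL i M)
  IdentityBlock-UL d a b a< b< = d a b (lower-half i a<) (lower-half i b<)

  IdentityBlock-LR : IdentityBlock (suc i) M → IdentityBlock i (LR i M)
  IdentityBlock-LR d a b a< b< =
    trans (d (a + 2 ^ i) (b + 2 ^ i) (upper-half i a<) (upper-half i b<)) (+-cancelʳ-≡ᵇ a b (2 ^ i))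

  IdentityBlock-UR : IdentityBlock (suc i) M → ZeroBlock i (UR i M)
  IdentityBlock-UR d a b a< b< =
    trans (d a (b + 2 ^ i) (lower-half i a<) (upper-half i b<))
          (≢⇒≡ᵇ-false (<⇒≢ (<-≤-trans a< (m≤n+m (2 ^ i) b))))

  IdentityBlock-LL : IdentityBlock (suc i) M → ZeroBlock i (LL i M)
  IdentityBlock-LL d a b a< b< =
    trans (d (a + 2 ^ i) b (upper-half i a<) (lower-half i b<))
          (≢⇒≡ᵇ-false (>⇒≢ (<-≤-trans b< (m≤n+m (2 ^ i) a))))

mutual
  rs-zero : ∀ i M → ZeroBlock i M → rs i M ≡ zeros (4 ^ i)
  rs-zero zero    M z = cong (_∷ []) (z 0 0 0<1+n 0<1+n)
  rs-zero (suc i) M z = zeros-quarters i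
    (ds-zero i _ (ZeroBlock-UL i z)) (rs-zero i _ (ZeroBlock-UR i z))
    (rs-zero i _ (ZeroBlock-LR i z)) (us-zero i _ (ZeroBlock-LL i z))

  ds-zero : ∀ i M → ZeroBlock i M → ds i M ≡ zeros (4 ^ i)
  ds-zero zero    M z = cong (_∷ []) (z 0 0 0<1+n 0<1+n)
  ds-zero (suc i) M z = zeros-quarters i
    (rs-zero i _ (ZeroBlock-UL i z)) (ds-zero i _ (ZeroBlock-LL i z))
    (ds-zero i _ (ZeroBlock-LR i z)) (ls-zero i _ (ZeroBlock-UR i z))

  us-zero : ∀ i M → ZeroBlock i M → us i M ≡ zeros (4 ^ i)
  us-zero zero    M z = cong (_∷ []) (z 0 0 0<1+n 0<1+n)
  us-zero (suc i) M z = zeros-quarters i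
    (ls-zero i _ (ZeroBlock-LR i z)) (us-zero i _ (ZeroBlock-UR i z))
    (us-zero i _ (ZeroBlock-UL i z)) (rs-zero i _ (ZeroBlock-LL i z))

  ls-zero : ∀ i M → ZeroBlock i M → ls i M ≡ zeros (4 ^ i)
  ls-zero zero    M z = cong (_∷ []) (z 0 0 0<1+n 0<1+n)
  ls-zero (suc i) M z = zeros-quarters i
    (us-zero i _ (ZeroBlock-LR i z)) (ls-zero i _ (ZeroBlock-LL i z))
    (ls-zero i _ (ZeroBlock-UL i z)) (ds-zero i _ (ZeroBlock-UR i z))

mutual
  rs-identity : ∀ i M → IdentityBlock i M → rs i M ≡ idScan i
  rs-identity zero    M d = cong (_∷ []) (d 0 0 0<1+n 0<1+n)
  rs-identity (suc i) M d =
    cong₂ _++_ (ds-identity i _ (IdentityBlock-UL i d))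
      (cong₂ _++_ (rs-zero i _ (IdentityBlock-UR i d))
        (cong₂ _++_ (rs-identity i _ (IdentityBlock-LR i d)) (us-zero i _ (IdentityBlock-LL i d))))

  ds-identity : ∀ i M → IdentityBlock i M → ds i M ≡ idScan i
  ds-identity zero    M d = cong (_∷ []) (d 0 0 0<1+n 0<1+n)
  ds-identity (suc i) M d =
    cong₂ _++_ (rs-identity i _ (IdentityBlock-UL i d))
      (cong₂ _++_ (ds-zero i _ (IdentityBlock-LL i d))
        (cong₂ _++_ (ds-identity i _ (IdentityBlock-LR i d)) (ls-zero i _ (IdentityBlock-UR i d))))

phlin-Id : ∀ k → phlin k Id ≡ idScan k
phlin-Id k with odd k
... | true  = rs-identity k Id (λ _ _ _ _ → refl)
... | false = ds-identity k Id (λ _ _ _ _ → refl)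

-- Occurrences of words in one-row schemes

entry : List Bool → ℕ → Bool
entry S = strMat S 0

entry-++ˡ : ∀ A {B} y → entry (A ++ B) (length A + y) ≡ entry B y
entry-++ˡ []      y = refl
entry-++ˡ (_ ∷ A) y = entry-++ˡ A y

entry-++ʳ : ∀ A {B} y → y < length A → entry (A ++ B) y ≡ entry A y
entry-++ʳ (_ ∷ A) zero    _        = refl
entry-++ʳ (_ ∷ A) (suc y) (s≤s y<) = entry-++ʳ A y y<

entry-zeros : ∀ n {B} y → y < n → entry (zeros n ++ B) y ≡ false
entry-zeros (suc n) zero    _        = refl
entry-zeros (suc n) (suc y) (s≤s y<) = entry-zeros n y y<

entry-after-zeros : ∀ n {B} → entry (zeros n ++ B) n ≡ entry B 0
entry-after-zeros zero    = refl
entry-after-zeros (suc n) = entry-after-zeros n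

record OccursAt (u S : List Bool) (a : ℕ) : Set where
  constructor occurs
  field
    fits    : a + length u ≤ length S
    matches : ∀ y → y < length u → entry S (a + y) ≡ entry u y

occursAt-++ : ∀ A u B → OccursAt u (A ++ u ++ B) (length A)
occursAt-++ A u B = occurs
  (subst (length A + length u ≤_) (sym (length-++ A)) (+-monoʳ-≤ (length A) (length-++-≤ˡ u)))
  (λ y y< → trans (entry-++ˡ A y) (entry-++ʳ u y y<))

end : Phrase → ℕ
end p = col p + w p

record Cuts (ℓ a : ℕ) (p : Phrase) : Set where
  constructor cuts
  field
    start<end : a < end p
    end<start+ℓ : end p < a + ℓ

m+n≤1⇒m≡0 : ∀ m {n} → m + n ≤ 1 → 1 ≤ n → m ≡ 0
m+n≤1⇒m≡0 m m+n≤1 1≤n = n≤0⇒n≡0 (+-cancelʳ-≤ 1 m 0 (≤-trans (+-monoʳ-≤ m 1≤n) m+n≤1))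

occursAt-copy : ∀ {S u c ht wd sc δ} →
                WellFormed 1 (length S) (strMat S) (phrase 0 c ht wd (just (0 , sc))) →
                δ + length u ≤ wd → OccursAt u S (c + δ) → OccursAt u S (sc + δ)
occursAt-copy {S} {u} {c} {_} {wd} {sc} {δ} (1≤ht , _ , _ , _ , _ , sc+wd≤ , _ , copy) δ+ℓ≤wd
              (occurs _ matches) = occurs
  (≤-trans (subst (_≤ sc + wd) (sym (+-assoc sc δ (length u))) (+-monoʳ-≤ sc δ+ℓ≤wd)) sc+wd≤)
  λ y y< → begin
    entry S (sc + δ + y)    ≡⟨ cong (entry S) (+-assoc sc δ y) ⟩
    entry S (sc + (δ + y))  ≡⟨ copy 0 (δ + y) 1≤ht (<-≤-trans (+-monoʳ-< δ y<) δ+ℓ≤wd) ⟩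
    entry S (c + (δ + y))   ≡⟨ cong (entry S) (sym (+-assoc c δ y)) ⟩
    entry S (c + δ + y)     ≡⟨ matches y y< ⟩
    entry u y               ∎
  where open ≡-Reasoning

phrase-cuts-or-copies : ∀ {S u a} p → WellFormed 1 (length S) (strMat S) p → Inside p 0 a →
  2 ≤ length u → OccursAt u S a →
  Cuts (length u) a p ⊎ ∃ λ a′ → OccursAt u S a′ × mapPhrase p (0 , a) ≡ just (0 , a′)
phrase-cuts-or-copies {a = a} p@(phrase _ c _ .1 nothing) (_ , _ , _ , refl) ∈p 2≤ℓ _
  with inside⇒bounds p ∈p
... | _ , _ , c≤a , a<c+1 = inj₁ (cuts a<c+1 (≤-<-trans (+-monoˡ-≤ 1 c≤a) (+-monoʳ-< a 2≤ℓ)))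
phrase-cuts-or-copies {S} {u} {a} p@(phrase r c ht wd (just (sr , sc))) wf ∈p 2≤ℓ occ
  with inside⇒bounds p ∈p | a + length u ≤? c + wd
... | _ , _ , _ , a<end | no ≰end = inj₁ (cuts a<end (≰⇒> ≰end))
... | _ , _ , c≤a , _ | yes ≤end with wf
... | 1≤ht , _ , r+ht≤1 , _ , sr+ht≤1 , _ with m+n≤1⇒m≡0 r r+ht≤1 1≤ht | m+n≤1⇒m≡0 sr sr+ht≤1 1≤ht
... | refl | refl =
  inj₂ (sc + δ , occursAt-copy wf δ+ℓ≤wd (subst (OccursAt u S) (sym c+δ≡a) occ) , refl)
  where
  δ = a ∸ c
  c+δ≡a : c + δ ≡ a
  c+δ≡a = m+[n∸m]≡n c≤a
  δ+ℓ≤wd : δ + length u ≤ wd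
  δ+ℓ≤wd = +-cancelˡ-≤ c _ _
    (subst (_≤ c + wd) (trans (cong (_+ length u) (sym c+δ≡a)) (+-assoc c δ _)) ≤end)

module _ {S : List Bool} {ps : List Phrase} (valid : ValidScheme 1 (length S) (strMat S) ps)
         {u : List Bool} (2≤ℓ : 2 ≤ length u) where

  private
    covers     = proj₁ (proj₁ valid)
    disjoint   = proj₂ (proj₁ valid)
    wellFormed = proj₁ (proj₂ valid)
    resolves   = proj₂ (proj₂ valid)

    start<length : ∀ {a} → OccursAt u S a → a < length S
    start<length {a} occ = <-≤-trans (m<m+n a (<-trans 0<1+n 2≤ℓ)) (OccursAt.fits occ)

  cuts-or-copies : ∀ {a} → OccursAt u S a →
    Any (Cuts (length u) a) ps ⊎ ∃ λ a′ → OccursAt u S a′ × mapPos ps (0 , a) ≡ just (0 , a′)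
  cuts-or-copies {a} occ with find (covers 0 a 0<1+n (start<length occ))
  ... | p , p∈ps , ∈p with phrase-cuts-or-copies p (wellFormed p p∈ps) ∈p 2≤ℓ occ
  ...   | inj₁ cut                = inj₁ (lose p∈ps cut)
  ...   | inj₂ (a′ , occ′ , a↦a′) =
    inj₂ (a′ , occ′ , trans (mapPos-inside 0 a disjoint p∈ps ∈p) a↦a′)

  private
    follow : ∀ t {a} → iterate (mapM ps) t (just (0 , a)) ≡ nothing → OccursAt u S a →
             ∃ λ a′ → OccursAt u S a′ × Any (Cuts (length u) a′) ps
    follow zero    ()  _
    follow (suc t) {a} a⇝⊥ occ with cuts-or-copies occ
    ... | inj₁ cut                = a , occ , cut
    ... | inj₂ (a′ , occ′ , a↦a′) = follow t a′⇝⊥ occ′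
      where
      open ≡-Reasoning
      a′⇝⊥ : iterate (mapM ps) t (just (0 , a′)) ≡ nothing
      a′⇝⊥ = begin
        iterate (mapM ps) t (just (0 , a′))            ≡⟨ cong (iterate (mapM ps) t) a↦a′ ⟨
        iterate (mapM ps) t (mapM ps (just (0 , a)))   ≡⟨ iterate-suc (mapM ps) t _ ⟨
        iterate (mapM ps) (suc t) (just (0 , a))       ≡⟨ a⇝⊥ ⟩
        nothing                                        ∎

  occurrence-cut : ∀ {a} → OccursAt u S a → ∃ λ a′ → OccursAt u S a′ × Any (Cuts (length u) a′) ps
  occurrence-cut {a} occ = let t , a⇝⊥ = resolves 0 a 0<1+n (start<length occ) in follow t a⇝⊥ occ

-- Gaps between ones

gapWord : ℕ → List Bool
gapWord n = true ∷ zeros n ++ true ∷ []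

length-gapWord : ∀ n → length (gapWord n) ≡ 2 + n
length-gapWord n = cong suc (begin
  length (zeros n ++ true ∷ [])  ≡⟨ length-++ (zeros n) ⟩
  length (zeros n) + 1           ≡⟨ cong (_+ 1) (length-replicate n) ⟩
  n + 1                          ≡⟨ +-comm n 1 ⟩
  suc n                          ∎)
  where open ≡-Reasoning

2≤length-gapWord : ∀ n → 2 ≤ length (gapWord n)
2≤length-gapWord n = subst (2 ≤_) (sym (length-gapWord n)) (s≤s (s≤s z≤n))

module _ {S : List Bool} {n a : ℕ} (occ : OccursAt (gapWord n) S a) where

  private
    at : ∀ y → y < 2 + n → entry S (a + y) ≡ entry (gapWord n) y
    at y y< = OccursAt.matches occ y (subst (y <_) (sym (length-gapWord n)) y<)

  gap-opens : entry S a ≡ true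
  gap-opens = trans (cong (entry S) (sym (+-identityʳ a))) (at 0 0<1+n)

  gap-closes : entry S (a + suc n) ≡ true
  gap-closes = trans (at (suc n) ≤-refl) (entry-after-zeros n)

  gap-interior : ∀ {b} → a < b → b < a + suc n → entry S b ≡ false
  gap-interior {b} a<b b<end with m≤n⇒∃[o]m+o≡n a<b
  ... | o , refl = begin
      entry S (suc a + o)              ≡⟨ cong (entry S) (+-suc a o) ⟨
      entry S (a + suc o)              ≡⟨ at (suc o) (s≤s (m≤n⇒m≤1+n o<n)) ⟩
      entry (zeros n ++ true ∷ []) o   ≡⟨ entry-zeros n o o<n ⟩
      false                            ∎
    where
    open ≡-Reasoning
    o<n : o < n
    o<n = +-cancelˡ-< a o n (≤-pred (subst (suc (a + o) <_) (+-suc a n) b<end))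

  one∉gap : ∀ {b} → a < b → b < a + suc n → entry S b ≢ true
  one∉gap a<b b<end b≡true with trans (sym b≡true) (gap-interior a<b b<end)
  ... | ()

cut-bound : ∀ {n a p} → Cuts (length (gapWord n)) a p → end p ≤ a + suc n
cut-bound {n} {a} {p} (cuts _ end<) =
  ≤-pred (subst (end p <_) (trans (cong (a +_) (length-gapWord n)) (+-suc a (suc n))) end<)

-- If m ≠ n, the occurrence starting later (or, at equal starts, ending earlier) has a 1
-- strictly inside the gap of the other.
gaps-cut-by-same-boundary : ∀ {S m n a₁ a₂ p} →
  OccursAt (gapWord m) S a₁ → OccursAt (gapWord n) S a₂ →
  Cuts (length (gapWord m)) a₁ p → Cuts (length (gapWord n)) a₂ p → m ≡ n
gaps-cut-by-same-boundary {m = m} {n} {a₁} {a₂} occ₁ occ₂ cut₁@(cuts a₁<E _) cut₂@(cuts a₂<E _)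
  with <-cmp a₁ a₂
... | tri< a₁<a₂ _ _ = ⊥-elim (one∉gap occ₁ a₁<a₂ (<-≤-trans a₂<E (cut-bound cut₁)) (gap-opens occ₂))
... | tri> _ _ a₂<a₁ = ⊥-elim (one∉gap occ₂ a₂<a₁ (<-≤-trans a₁<E (cut-bound cut₂)) (gap-opens occ₁))
... | tri≈ _ refl _ with <-cmp m n
...   | tri< m<n _ _ = ⊥-elim (one∉gap occ₂ (m<m+n a₁ 0<1+n) (+-monoʳ-< a₁ (s≤s m<n)) (gap-closes occ₁))
...   | tri≈ _ m≡n _ = m≡n
...   | tri> _ _ n<m = ⊥-elim (one∉gap occ₁ (m<m+n a₁ 0<1+n) (+-monoʳ-< a₁ (s≤s n<m)) (gap-closes occ₂))

distinct-gaps≤phrases : ∀ {S ps k} → ValidScheme 1 (length S) (strMat S) ps →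
  (gap : Fin k → ℕ) → Injective _≡_ _≡_ gap → (∀ j → ∃ (OccursAt (gapWord (gap j)) S)) →
  k ≤ length ps
distinct-gaps≤phrases {S} {ps} {k} valid gap gap-injective occurrence =
  injective⇒≤ {f = cutting-phrase} cutting-phrase-injective
  where
  cut : ∀ j → ∃ λ a → OccursAt (gapWord (gap j)) S a × Any (Cuts (length (gapWord (gap j))) a) ps
  cut j = occurrence-cut valid (2≤length-gapWord (gap j)) (proj₂ (occurrence j))
  cutting-phrase : Fin k → Fin (length ps)
  cutting-phrase j = index (proj₂ (proj₂ (cut j)))
  cutting-phrase-injective : Injective _≡_ _≡_ cutting-phrase
  cutting-phrase-injective {j₁} {j₂} same = gap-injective
    (gaps-cut-by-same-boundary (proj₁ (proj₂ (cut j₁))) (proj₁ (proj₂ (cut j₂)))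
      (lookup-index (proj₂ (proj₂ (cut j₁))))
      (subst (λ i → Cuts _ _ (lookup ps i)) (sym same) (lookup-index (proj₂ (proj₂ (cut j₂))))))

repunit₄ : ℕ → ℕ
repunit₄ zero    = 0
repunit₄ (suc j) = repunit₄ j + 4 ^ j

repunit₄-strictMono : ∀ {m n} → m < n → repunit₄ m < repunit₄ n
repunit₄-strictMono {m} {suc n} (s≤s m≤n) with m≤n⇒m<n∨m≡n m≤n
... | inj₁ m<n  = <-≤-trans (repunit₄-strictMono m<n) (m≤m+n (repunit₄ n) _)
... | inj₂ refl = m<m+n (repunit₄ m) (m^n>0 4 m)

repunit₄-injective : ∀ {m n} → repunit₄ m ≡ repunit₄ n → m ≡ n
repunit₄-injective {m} {n} eq with <-cmp m n
... | tri< m<n _ _ = ⊥-elim (<⇒≢ (repunit₄-strictMono m<n) eq)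
... | tri≈ _ m≡n _ = m≡n
... | tri> _ _ n<m = ⊥-elim (>⇒≢ (repunit₄-strictMono n<m) eq)

idScan-head : ∀ j → ∃ λ Q → idScan j ≡ true ∷ Q
idScan-head zero    = [] , refl
idScan-head (suc j) with idScan-head j
... | Q , eq = _ , cong (λ X → X ++ zeros (4 ^ j) ++ idScan j ++ zeros (4 ^ j)) eq

idScan-last : ∀ j → ∃ λ P → idScan j ≡ P ++ true ∷ zeros (repunit₄ j)
idScan-last zero    = [] , refl
idScan-last (suc j) with idScan-last j
... | P , eq = idScan j ++ Z ++ P , (begin
    idScan j ++ Z ++ idScan j ++ Z                    ≡⟨ cong (λ X → idScan j ++ Z ++ X ++ Z) eq ⟩
    idScan j ++ Z ++ (P ++ true ∷ zeros r) ++ Z       ≡⟨ regroup (idScan j) Z P (true ∷ []) (zeros r) ⟩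
    (idScan j ++ Z ++ P) ++ true ∷ zeros r ++ Z
      ≡⟨ cong (λ X → (idScan j ++ Z ++ P) ++ true ∷ X) (zeros-++ r (4 ^ j)) ⟩
    (idScan j ++ Z ++ P) ++ true ∷ zeros (r + 4 ^ j)  ∎)
  where
  open ≡-Reasoning
  Z = zeros (4 ^ j)
  r = repunit₄ j
  regroup : ∀ (I Z P o Y : List Bool) → I ++ Z ++ (P ++ o ++ Y) ++ Z ≡ (I ++ Z ++ P) ++ o ++ Y ++ Z
  regroup _ _ _ _ _ = solve (++-monoid Bool)

idScan-prefix : ∀ d j → ∃ λ R → idScan (d + j) ≡ idScan j ++ R
idScan-prefix zero    j = [] , sym (++-identityʳ (idScan j))
idScan-prefix (suc d) j with idScan-prefix d j
... | R , eq = R ++ Z ++ idScan (d + j) ++ Z ,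
               trans (cong (_++ Z ++ idScan (d + j) ++ Z) eq) (++-assoc (idScan j) R _)
  where Z = zeros (4 ^ (d + j))

-- The last 1 of the first half and the first 1 of the second half of idScan (suc j)
-- enclose the trailing zeros of idScan j followed by 0^(4^j).
idScan-gap : ∀ {j k} → j < k → ∃₂ λ A B → idScan k ≡ A ++ gapWord (repunit₄ (suc j)) ++ B
idScan-gap {j} {k} j<k with idScan-last j | idScan-head j | idScan-prefix (k ∸ suc j) (suc j)
... | P , last | Q , head | R , prefix = P , (Q ++ Z) ++ R , (begin
    idScan k                                            ≡⟨ cong idScan (m∸n+n≡m j<k) ⟨
    idScan (k ∸ suc j + suc j)                          ≡⟨ prefix ⟩
    (idScan j ++ Z ++ idScan j ++ Z) ++ R               ≡⟨ cong₂ (λ X Y → (X ++ Z ++ Y ++ Z) ++ R) last head ⟩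
    ((P ++ true ∷ zeros r) ++ Z ++ (true ∷ Q) ++ Z) ++ R ≡⟨ regroup P (true ∷ []) (zeros r) Z Q R ⟩
    P ++ (true ∷ (zeros r ++ Z) ++ true ∷ []) ++ (Q ++ Z) ++ R
      ≡⟨ cong (λ X → P ++ (true ∷ X ++ true ∷ []) ++ (Q ++ Z) ++ R) (zeros-++ r (4 ^ j)) ⟩
    P ++ gapWord (repunit₄ (suc j)) ++ (Q ++ Z) ++ R     ∎)
  where
  open ≡-Reasoning
  Z = zeros (4 ^ j)
  r = repunit₄ j
  regroup : ∀ (P o Y Z Q R : List Bool) →
            ((P ++ o ++ Y) ++ Z ++ (o ++ Q) ++ Z) ++ R ≡ P ++ (o ++ (Y ++ Z) ++ o) ++ (Q ++ Z) ++ R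
  regroup _ _ _ _ _ _ = solve (++-monoid Bool)

idScan-lower-bound : ∀ k {ps} → ValidScheme 1 (length (idScan k)) (strMat (idScan k)) ps →
                     k ≤ length ps
idScan-lower-bound k valid = distinct-gaps≤phrases valid gap gap-injective occurrence
  where
  gap : Fin k → ℕ
  gap j = repunit₄ (suc (toℕ j))
  gap-injective : Injective _≡_ _≡_ gap
  gap-injective = toℕ-injective ∘ suc-injective ∘ repunit₄-injective
  occurrence : ∀ j → ∃ (OccursAt (gapWord (gap j)) (idScan k))
  occurrence j with idScan-gap (toℕ<n j)
  ... | A , B , eq =
    length A , subst (λ S → OccursAt (gapWord (gap j)) S (length A)) (sym eq) (occursAt-++ A _ B)

proposition14 : (Σ ℕ λ C → ∀ k → b≤ (2 ^ k) (2 ^ k) Id C)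
    × (Σ ℕ λ d → Σ ℕ λ k₀ → ∀ k → k₀ ≤ k →
         ∀ ps → ValidScheme 1 (length (phlin k Id)) (strMat (phlin k Id)) ps →
         k ≤ d * length ps)
proposition14 = (6 , λ k → b≤-Id (2 ^ k)) , (1 , 0 , lower-bound)
  where
  lower-bound : ∀ k → 0 ≤ k → ∀ ps → ValidScheme 1 (length (phlin k Id)) (strMat (phlin k Id)) ps →
                k ≤ 1 * length ps
  lower-bound k _ ps valid rewrite phlin-Id k | *-identityˡ (length ps) = idScan-lower-bound k valid
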